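{- Let $A$ and $B$ be finitely generated abelian $p$-groups (written additively) and $N:B\to A$, $\iota:A\to B$ $\mathbb{Z}_p$-linear maps such that: (1) $N$ is surjective and $\iota$ is injective; (2) the $p$-ranks of $A$ and $B$ are both equal to $r$ and $|B|/|A|=p^r$; (3) $N(\iota(a))=pa$ for all $a\in A$ and $p\text{ -rk}(\iota(A))=p\text{ -rk}(A)$. Then $\iota(A)=pB$ and $\mathrm{ord}(x)=p\cdot\mathrm{ord}(Nx)$ for all nonzero $x\in B$.
   Context: For a finite abelian $p$-group $X$, $p\text{ -rk}(X)=\dim_{\mathbb{F}_p}(X/pX)$. -}

module Defs where

open import Level using (Level; _⊔_)
open import Data.Nat using (ℕ; zero; suc; _≤_; _<_; _*_; _^_)
open import Data.Fin using (Fin; zero; suc)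
open import Data.Product using (Σ; ∃; _×_; _,_)
open import Function using (_∘_)
open import Algebra.Bundles using (AbelianGroup)
import Algebra.Definitions.RawMonoid as RawMonoidDefs
import Algebra.Morphism.Structures as MorphismStructures

private variable c ℓ c₂ ℓ₂ s : Level

module _ (G : AbelianGroup c ℓ) where
  open AbelianGroup G

  _·_ : ℕ → Carrier → Carrier
  _·_ = RawMonoidDefs._×_ rawMonoid

  lincomb : (k : ℕ) → (Fin k → Carrier) → (Fin k → ℕ) → Carrier
  lincomb zero    xs cs = ε
  lincomb (suc k) xs cs = (cs zero · xs zero) ∙ lincomb k (xs ∘ suc) (cs ∘ suc)

  HasCard : ℕ → Set (c ⊔ ℓ)
  HasCard n = Σ (Fin n → Carrier) λ f →
                (∀ i j → f i ≈ f j → i ≡ j) × (∀ x → ∃ λ i → f i ≈ x)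
    where open import Relation.Binary.PropositionalEquality using (_≡_)

  IsPGroup : ℕ → Set (c ⊔ ℓ)
  IsPGroup p = ∀ x → ∃ λ k → ((p ^ k) · x) ≈ ε

  -- For a subgroup S (given by a predicate) of a p-group:
  -- k elements of S whose images span S/pS over 𝔽_p
  -- (coefficients in ℕ, taken mod p implicitly).
  SpansModP : ℕ → (Carrier → Set s) → ℕ → Set (c ⊔ ℓ ⊔ s)
  SpansModP p S k =
    Σ (Fin k → Carrier) λ xs → (∀ i → S (xs i)) ×
      (∀ x → S x → Σ (Fin k → ℕ) λ cs → Σ Carrier λ t →
          S t × (x ≈ (lincomb k xs cs ∙ (p · t))))

  -- p-rk(S) = dim_{𝔽_p}(S/pS) = r : the least size of a spanning family of S/pS
  HasPRank : ℕ → (Carrier → Set s) → ℕ → Set (c ⊔ ℓ ⊔ s)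
  HasPRank p S r = SpansModP p S r × (∀ k → SpansModP p S k → r ≤ k)

  IsOrder : Carrier → ℕ → Set ℓ
  IsOrder x n = (0 < n) × ((n · x) ≈ ε) ×
                (∀ m → 0 < m → (m · x) ≈ ε → n ≤ m)

-- group homomorphism between abelian groups (automatically ℤ_p-linear for p-groups)
IsHom : (G : AbelianGroup c ℓ) (H : AbelianGroup c₂ ℓ₂) →
        (AbelianGroup.Carrier G → AbelianGroup.Carrier H) → Set (c ⊔ ℓ ⊔ ℓ₂)
IsHom G H f = MorphismStructures.GroupMorphisms.IsGroupHomomorphism
                (AbelianGroup.rawGroup G) (AbelianGroup.rawGroup H) f

{-# OPTIONS --safe #-}
module Submission where

-- Everything follows by counting. In a finite abelian group G of p-rank r a minimal spanning
-- family of G/pG is a basis, so |G| = pʳ |pG|; counting the fibres of multiplication by p then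
-- gives |G[p]| = pʳ. Counting the fibres of N gives |ker N| = |B| / |A| = pʳ, and ι(A[p]) has pʳ
-- elements and lies in both ker N and B[p] since N ∘ ι = p, so ker N = ι(A[p]) = B[p]. Likewise
-- N⁻¹(pA) has |pA| pʳ = |A| = |ι(A)| elements and contains ι(A), so it equals ι(A); it contains pB,
-- and |pB| = |B| / pʳ = |A|, whence ι(A) = pB. Finally, as ker N = B[p], for x ≠ 0 of order
-- m = p m′ the element m′ x is killed by N and n x by p, where n = ord (N x); so n = m′.

open import Defs
open import Level using (Level; _⊔_)
open import Algebra.Bundles using (AbelianGroup)
open import Algebra.Morphism.Structures using (module GroupMorphisms)
open import Data.Empty using (⊥-elim)
open import Data.Fin using (Fin; zero; suc; toℕ; fromℕ<; punchIn; combine; remQuot; finToFun; funToFin)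
import Data.Fin.Properties as Finₚ
open import Data.List using (filter; allFin; lookup; length)
import Data.List.Relation.Unary.Any as Any
import Data.List.Relation.Unary.Any.Properties as Anyₚ
import Data.List.Relation.Unary.All as All
import Data.List.Relation.Unary.AllPairs as AllPairs
open import Data.List.Relation.Unary.Unique.Propositional using (Unique)
import Data.List.Relation.Unary.Unique.Propositional.Properties as Uniqueₚ
open import Data.List.Membership.Propositional.Properties using (∈-filter⁺; ∈-filter⁻; ∈-allFin; ∈-lookup)
open import Data.Nat as ℕ using (ℕ; zero; suc; _+_; _*_; _^_; _≤_; _<_; pred; NonZero)
import Data.Nat.Properties as ℕₚ
open import Data.Nat.DivMod using (_%_; _/_; m≡m%n+[m/n]*n; m%n<n; m<n⇒m%n≡m; [m+kn]%n≡m%n; %-remove-+ˡ; m*[n/m]≡n)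
open import Data.Nat.Divisibility using (_∣_; _∣?_; ∣1⇒≡1; m%n≡0⇒n∣m)
open import Data.Nat.Primality using (Prime; prime⇒nonZero; prime⇒irreducible)
open import Data.Nat.Coprimality using (Coprime; coprime-Bézout; coprime-divisor)
open import Data.Nat.GCD using (module Bézout)
open import Data.Sum using (inj₁; inj₂)
open import Data.Product using (∃; ∃₂; _×_; _,_; proj₁; proj₂; uncurry)
open import Data.Unit.Polymorphic using (⊤; tt)
open import Function using (_∘_)
open import Relation.Binary.Bundles using (Setoid; Preorder)
import Relation.Binary.Reasoning.Preorder
import Relation.Binary.Reasoning.Setoid
open import Relation.Binary.Definitions using (_Respects_)
open import Relation.Binary.PropositionalEquality as ≡ using (_≡_; _≢_; _≗_)
open import Relation.Nullary using (¬_; Dec; yes; no)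
open import Relation.Nullary.Decidable using (_×-dec_)
open import Relation.Unary using (Pred; _⊆_; Decidable)

private variable c ℓ c₁ ℓ₁ c₂ ℓ₂ s : Level

∤⇒coprime : ∀ {p d} → Prime p → ¬ p ∣ d → Coprime d p
∤⇒coprime p-prime p∤d (e∣d , e∣p) with prime⇒irreducible p-prime e∣p
... | inj₁ e≡1    = e≡1
... | inj₂ ≡.refl = ⊥-elim (p∤d e∣d)

∣prime^⇒∣ : ∀ {p m} → Prime p → ∀ k → m ∣ p ^ k → m ≢ 1 → p ∣ m
∣prime^⇒∣ p-prime zero m∣1 m≢1 = ⊥-elim (m≢1 (∣1⇒≡1 m∣1))
∣prime^⇒∣ {p} {m} p-prime (suc k) m∣p^k+1 m≢1 with p ∣? m
... | yes p∣m = p∣m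
... | no  p∤m = ∣prime^⇒∣ p-prime k (coprime-divisor (∤⇒coprime p-prime p∤m) m∣p^k+1) m≢1

-- a + (p - 1) b ≡ a - b (mod p), with the subtraction avoided
distinct⇒∤ : ∀ {p a b} .{{_ : NonZero p}} → a < p → b < p → a ≢ b → ¬ p ∣ a + pred p * b
distinct⇒∤ {p} {a} {b} a<p b<p a≢b p∣ = a≢b (begin
  a                        ≡⟨ m<n⇒m%n≡m a<p ⟨
  a % p                    ≡⟨ [m+kn]%n≡m%n a b p ⟨
  (a + b * p) % p          ≡⟨ ≡.cong (_% p) a+b*p≡ ⟩
  (a + pred p * b + b) % p ≡⟨ %-remove-+ˡ b p∣ ⟩
  b % p                    ≡⟨ m<n⇒m%n≡m b<p ⟩
  b                        ∎)
  where
  open ≡.≡-Reasoning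
  a+b*p≡ : a + b * p ≡ a + pred p * b + b
  a+b*p≡ = begin
    a + b * p              ≡⟨ ≡.cong (λ q → a + b * q) (ℕₚ.suc-pred p) ⟨
    a + b * suc (pred p)   ≡⟨ ≡.cong (a +_) (ℕₚ.*-suc b (pred p)) ⟩
    a + (b + b * pred p)   ≡⟨ ≡.cong (λ q → a + (b + q)) (ℕₚ.*-comm b (pred p)) ⟩
    a + (b + pred p * b)   ≡⟨ ≡.cong (a +_) (ℕₚ.+-comm b _) ⟩
    a + (pred p * b + b)   ≡⟨ ℕₚ.+-assoc a _ b ⟨
    a + pred p * b + b     ∎

funToFin-cong : ∀ {m n} {f g : Fin m → Fin n} → f ≗ g → funToFin f ≡ funToFin g
funToFin-cong {zero}  _    = ≡.refl
funToFin-cong {suc m} f≗g = ≡.cong₂ combine (f≗g zero) (funToFin-cong (f≗g ∘ suc))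

finToFun-injective : ∀ {m n} {a b : Fin (n ^ m)} → finToFun {n} {m} a ≗ finToFun b → a ≡ b
finToFun-injective {m} {n} {a} {b} eq = begin
  a                                     ≡⟨ Finₚ.funToFin-finToFin {m} {n} a ⟨
  funToFin {m} {n} (finToFun {n} {m} a) ≡⟨ funToFin-cong eq ⟩
  funToFin {m} {n} (finToFun {n} {m} b) ≡⟨ Finₚ.funToFin-finToFin {m} {n} b ⟩
  b                                     ∎
  where open ≡.≡-Reasoning

lookup-injective : ∀ {a} {A : Set a} {xs} → Unique xs → ∀ i j → lookup {A = A} xs i ≡ lookup xs j → i ≡ j
lookup-injective (_  AllPairs.∷ _)  zero    zero    _  = ≡.refl
lookup-injective (x∉ AllPairs.∷ _)  zero    (suc j) eq = ⊥-elim (All.lookup x∉ (∈-lookup j) eq)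
lookup-injective (x∉ AllPairs.∷ _)  (suc i) zero    eq = ⊥-elim (All.lookup x∉ (∈-lookup i) (≡.sym eq))
lookup-injective (_  AllPairs.∷ u) (suc i) (suc j) eq = ≡.cong suc (lookup-injective u i j eq)

module Multiples (G : AbelianGroup c ℓ) where
  open AbelianGroup G
  open import Algebra.Properties.Monoid.Mult monoid using (×-congʳ; ×-homo-+; ×-assocˡ)
  open import Algebra.Properties.CommutativeMonoid.Mult commutativeMonoid using (×-distrib-+)
  open import Algebra.Properties.Group group using (inverseʳ-unique)
  open import Algebra.Properties.CommutativeSemigroup commutativeSemigroup using (interchange; x∙yz≈y∙xz)
  open import Relation.Binary.Reasoning.Setoid setoid

  infixr 8 _⋆_
  _⋆_ : ℕ → Carrier → Carrier
  _⋆_ = _·_ G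

  ⋆-congʳ : ∀ n {x y} → x ≈ y → n ⋆ x ≈ n ⋆ y
  ⋆-congʳ = ×-congʳ

  ⋆-congˡ : ∀ {m n} x → m ≡ n → m ⋆ x ≈ n ⋆ x
  ⋆-congˡ x ≡.refl = refl

  ⋆-homo-+ : ∀ m n x → (m + n) ⋆ x ≈ m ⋆ x ∙ n ⋆ x
  ⋆-homo-+ m n x = ×-homo-+ x m n

  ⋆-assoc : ∀ m n x → m ⋆ (n ⋆ x) ≈ (m * n) ⋆ x
  ⋆-assoc m n x = ×-assocˡ x m n

  ⋆-comm : ∀ m n x → m ⋆ (n ⋆ x) ≈ n ⋆ (m ⋆ x)
  ⋆-comm m n x = begin
    m ⋆ (n ⋆ x)  ≈⟨ ⋆-assoc m n x ⟩
    (m * n) ⋆ x  ≈⟨ ⋆-congˡ x (ℕₚ.*-comm m n) ⟩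
    (n * m) ⋆ x  ≈⟨ ⋆-assoc n m x ⟨
    n ⋆ (m ⋆ x)  ∎

  ⋆-distrib-∙ : ∀ n x y → n ⋆ (x ∙ y) ≈ n ⋆ x ∙ n ⋆ y
  ⋆-distrib-∙ n x y = ×-distrib-+ x y n

  ⋆-ε : ∀ n → n ⋆ ε ≈ ε
  ⋆-ε zero    = refl
  ⋆-ε (suc n) = trans (∙-cong refl (⋆-ε n)) (identityˡ ε)

  ⋆-⁻¹ : ∀ n x → n ⋆ (x ⁻¹) ≈ (n ⋆ x) ⁻¹
  ⋆-⁻¹ n x = inverseʳ-unique (n ⋆ x) (n ⋆ (x ⁻¹)) (begin
    n ⋆ x ∙ n ⋆ (x ⁻¹)  ≈⟨ ⋆-distrib-∙ n x (x ⁻¹) ⟨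
    n ⋆ (x ∙ x ⁻¹)      ≈⟨ ⋆-congʳ n (inverseʳ x) ⟩
    n ⋆ ε               ≈⟨ ⋆-ε n ⟩
    ε                   ∎)

  ⋆-isHom : ∀ n → IsHom G G (n ⋆_)
  ⋆-isHom n = record
    { isMonoidHomomorphism = record
      { isMagmaHomomorphism = record
        { isRelHomomorphism = record { cong = ⋆-congʳ n }
        ; homo              = ⋆-distrib-∙ n }
      ; ε-homo = ⋆-ε n }
    ; ⁻¹-homo = ⋆-⁻¹ n }

  lincomb-+ : ∀ k xs (cs ds : Fin k → ℕ) →
              lincomb G k xs (λ i → cs i + ds i) ≈ lincomb G k xs cs ∙ lincomb G k xs ds
  lincomb-+ zero    xs cs ds = sym (identityˡ ε)
  lincomb-+ (suc k) xs cs ds = trans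
    (∙-cong (⋆-homo-+ (cs zero) (ds zero) (xs zero)) (lincomb-+ k (xs ∘ suc) (cs ∘ suc) (ds ∘ suc)))
    (interchange _ _ _ _)

  lincomb-cong : ∀ k xs {cs ds : Fin k → ℕ} → cs ≗ ds → lincomb G k xs cs ≈ lincomb G k xs ds
  lincomb-cong zero    xs eq = refl
  lincomb-cong (suc k) xs eq = ∙-cong (⋆-congˡ (xs zero) (eq zero)) (lincomb-cong k (xs ∘ suc) (eq ∘ suc))

  ⋆-lincomb : ∀ n k xs (cs : Fin k → ℕ) →
              n ⋆ lincomb G k xs cs ≈ lincomb G k xs (λ i → n * cs i)
  ⋆-lincomb n zero    xs cs = ⋆-ε n
  ⋆-lincomb n (suc k) xs cs = trans (⋆-distrib-∙ n _ _)
    (∙-cong (⋆-assoc n (cs zero) (xs zero)) (⋆-lincomb n k (xs ∘ suc) (cs ∘ suc)))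

  lincomb-punchIn : ∀ k xs (cs : Fin (suc k) → ℕ) j →
    lincomb G (suc k) xs cs ≈ cs j ⋆ xs j ∙ lincomb G k (xs ∘ punchIn j) (cs ∘ punchIn j)
  lincomb-punchIn k       xs cs zero    = refl
  lincomb-punchIn (suc k) xs cs (suc j) = trans
    (∙-cong refl (lincomb-punchIn k (xs ∘ suc) (cs ∘ suc) j))
    (x∙yz≈y∙xz _ _ _)

  IsOrder⇒∣ : ∀ {x m k} → IsOrder G x m → k ⋆ x ≈ ε → m ∣ k
  IsOrder⇒∣ {x} {m} {k} (m>0 , m⋆x≈ε , minimal) k⋆x≈ε = m%n≡0⇒n∣m k m k%m≡0
    where
    instance
      m≢0 : NonZero m
      m≢0 = ℕ.>-nonZero m>0
    [k%m]⋆x≈ε : (k % m) ⋆ x ≈ ε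
    [k%m]⋆x≈ε = begin
      (k % m) ⋆ x                        ≈⟨ identityʳ _ ⟨
      (k % m) ⋆ x ∙ ε                    ≈⟨ ∙-cong refl (⋆-ε (k / m)) ⟨
      (k % m) ⋆ x ∙ (k / m) ⋆ ε          ≈⟨ ∙-cong refl (⋆-congʳ (k / m) m⋆x≈ε) ⟨
      (k % m) ⋆ x ∙ (k / m) ⋆ m ⋆ x      ≈⟨ ∙-cong refl (⋆-assoc (k / m) m x) ⟩
      (k % m) ⋆ x ∙ (k / m * m) ⋆ x      ≈⟨ ⋆-homo-+ (k % m) _ x ⟨
      (k % m + k / m * m) ⋆ x            ≈⟨ ⋆-congˡ x (m≡m%n+[m/n]*n k m) ⟨
      k ⋆ x                              ≈⟨ k⋆x≈ε ⟩
      ε                                  ∎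
    k%m≡0 : k % m ≡ 0
    k%m≡0 with k % m in k%m≡ | [k%m]⋆x≈ε
    ... | zero  | _  = ≡.refl
    ... | suc j | eq = ⊥-elim (ℕₚ.<⇒≱ (m%n<n k m) (≡.subst (m ≤_) (≡.sym k%m≡) (minimal (suc j) ℕ.z<s eq)))

module Congruence (G : AbelianGroup c ℓ) (p : ℕ) where
  open AbelianGroup G
  open Multiples G
  open import Algebra.Properties.CommutativeSemigroup commutativeSemigroup using (interchange)
  private module ≈-Reasoning = Relation.Binary.Reasoning.Setoid setoid

  infix 4 _∼_
  _∼_ : Carrier → Carrier → Set (c ⊔ ℓ)
  x ∼ y = ∃ λ t → x ≈ y ∙ p ⋆ t

  ∼-reflexive : ∀ {x y} → x ≈ y → x ∼ y
  ∼-reflexive {x} {y} x≈y = ε , (begin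
    x          ≈⟨ x≈y ⟩
    y          ≈⟨ identityʳ y ⟨
    y ∙ ε      ≈⟨ ∙-cong refl (⋆-ε p) ⟨
    y ∙ p ⋆ ε  ∎)
    where open ≈-Reasoning

  ∼-sym : ∀ {x y} → x ∼ y → y ∼ x
  ∼-sym {x} {y} (t , x≈) = t ⁻¹ , (begin
    y                          ≈⟨ identityʳ y ⟨
    y ∙ ε                      ≈⟨ ∙-cong refl (inverseʳ (p ⋆ t)) ⟨
    y ∙ (p ⋆ t ∙ (p ⋆ t) ⁻¹)   ≈⟨ assoc y (p ⋆ t) _ ⟨
    (y ∙ p ⋆ t) ∙ (p ⋆ t) ⁻¹   ≈⟨ ∙-cong x≈ (⋆-⁻¹ p t) ⟨
    x ∙ p ⋆ (t ⁻¹)             ∎)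
    where open ≈-Reasoning

  ∼-trans : ∀ {x y z} → x ∼ y → y ∼ z → x ∼ z
  ∼-trans {x} {y} {z} (t , x≈) (u , y≈) = u ∙ t , (begin
    x                  ≈⟨ x≈ ⟩
    y ∙ p ⋆ t          ≈⟨ ∙-cong y≈ refl ⟩
    (z ∙ p ⋆ u) ∙ p ⋆ t ≈⟨ assoc z _ _ ⟩
    z ∙ (p ⋆ u ∙ p ⋆ t) ≈⟨ ∙-cong refl (⋆-distrib-∙ p u t) ⟨
    z ∙ p ⋆ (u ∙ t)    ∎)
    where open ≈-Reasoning

  ∼-preorder : Preorder c ℓ (c ⊔ ℓ)
  ∼-preorder = record
    { Carrier = Carrier ; _≈_ = _≈_ ; _≲_ = _∼_
    ; isPreorder = record { isEquivalence = isEquivalence ; reflexive = ∼-reflexive ; trans = ∼-trans } }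

  module ∼-Reasoning = Relation.Binary.Reasoning.Preorder ∼-preorder

  ∼-∙-cong : ∀ {x x′ y y′} → x ∼ x′ → y ∼ y′ → x ∙ y ∼ x′ ∙ y′
  ∼-∙-cong {x} {x′} {y} {y′} (t , x≈) (u , y≈) = t ∙ u , (begin
    x ∙ y                        ≈⟨ ∙-cong x≈ y≈ ⟩
    (x′ ∙ p ⋆ t) ∙ (y′ ∙ p ⋆ u)  ≈⟨ interchange _ _ _ _ ⟩
    (x′ ∙ y′) ∙ (p ⋆ t ∙ p ⋆ u)  ≈⟨ ∙-cong refl (⋆-distrib-∙ p t u) ⟨
    (x′ ∙ y′) ∙ p ⋆ (t ∙ u)      ∎)
    where open ≈-Reasoning

  ∼-⋆-cong : ∀ n {x y} → x ∼ y → n ⋆ x ∼ n ⋆ y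
  ∼-⋆-cong n {x} {y} (t , x≈) = n ⋆ t , (begin
    n ⋆ x              ≈⟨ ⋆-congʳ n x≈ ⟩
    n ⋆ (y ∙ p ⋆ t)    ≈⟨ ⋆-distrib-∙ n y _ ⟩
    n ⋆ y ∙ n ⋆ p ⋆ t  ≈⟨ ∙-cong refl (⋆-comm n p t) ⟩
    n ⋆ y ∙ p ⋆ n ⋆ t  ∎)
    where open ≈-Reasoning

  p⋆x∼ε : ∀ x → p ⋆ x ∼ ε
  p⋆x∼ε x = x , sym (identityˡ (p ⋆ x))

  lincomb-∼ : ∀ k xs (cs ds : Fin k → ℕ) → (∀ i → cs i ⋆ xs i ∼ ds i ⋆ xs i) →
              lincomb G k xs cs ∼ lincomb G k xs ds
  lincomb-∼ zero    xs cs ds _  = ∼-reflexive refl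
  lincomb-∼ (suc k) xs cs ds eq =
    ∼-∙-cong (eq zero) (lincomb-∼ k (xs ∘ suc) (cs ∘ suc) (ds ∘ suc) (eq ∘ suc))

  -- (p - 1) ⋆ y stands in for y ⁻¹ modulo pG, keeping coefficients natural
  ∙∼ε⇒∼pred-⋆ : .{{NonZero p}} → ∀ {x y} → x ∙ y ∼ ε → x ∼ pred p ⋆ y
  ∙∼ε⇒∼pred-⋆ {x} {y} xy∼ε = begin
    x                        ≈⟨ identityʳ x ⟨
    x ∙ ε                    ∼⟨ ∼-∙-cong (∼-reflexive refl) (∼-sym (p⋆x∼ε y)) ⟩
    x ∙ p ⋆ y                ≈⟨ ∙-cong refl (⋆-congˡ y (ℕₚ.suc-pred p)) ⟨
    x ∙ (y ∙ pred p ⋆ y)     ≈⟨ assoc x y _ ⟨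
    (x ∙ y) ∙ pred p ⋆ y     ∼⟨ ∼-∙-cong xy∼ε (∼-reflexive refl) ⟩
    ε ∙ pred p ⋆ y           ≈⟨ identityˡ _ ⟩
    pred p ⋆ y               ∎
    where open ∼-Reasoning

module Counting (S : Setoid c ℓ) where
  open Setoid S

  record Card (P : Pred Carrier s) (k : ℕ) : Set (c ⊔ ℓ ⊔ s) where
    field
      enum            : Fin k → Carrier
      enum-∈          : ∀ i → P (enum i)
      enum-injective  : ∀ i j → enum i ≈ enum j → i ≡ j
      enum-surjective : ∀ {x} → P x → ∃ λ i → enum i ≈ x
  open Card public

  private variable
    P Q : Pred Carrier s
    k l : ℕ

  injection⇒≤ : (e : Fin k → Carrier) → (∀ i → Q (e i)) → (∀ i j → e i ≈ e j → i ≡ j) →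
                Card Q l → k ≤ l
  injection⇒≤ e e∈Q e-injective C = Finₚ.injective⇒≤ index-injective
    where
    index : Fin _ → Fin _
    index i = proj₁ (enum-surjective C (e∈Q i))
    index-injective : ∀ {i j} → index i ≡ index j → i ≡ j
    index-injective {i} {j} eq = e-injective i j (begin
      e i                  ≈⟨ proj₂ (enum-surjective C (e∈Q i)) ⟨
      enum C (index i)     ≡⟨ ≡.cong (enum C) eq ⟩
      enum C (index j)     ≈⟨ proj₂ (enum-surjective C (e∈Q j)) ⟩
      e j                  ∎)
      where open Relation.Binary.Reasoning.Setoid S

  Card-mono : P ⊆ Q → Card P k → Card Q l → k ≤ l
  Card-mono P⊆Q C D = injection⇒≤ (enum C) (P⊆Q ∘ enum-∈ C) (enum-injective C) D

  Card-unique : Card P k → Card P l → k ≡ l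
  Card-unique C D = ℕₚ.≤-antisym (Card-mono (λ x → x) C D) (Card-mono (λ x → x) D C)

  Card-resp : P ⊆ Q → Q ⊆ P → Card P k → Card Q k
  Card-resp P⊆Q Q⊆P C = record
    { enum = enum C ; enum-∈ = P⊆Q ∘ enum-∈ C ; enum-injective = enum-injective C
    ; enum-surjective = enum-surjective C ∘ Q⊆P }

  Card-positive : ∀ {x} → P x → Card P k → 0 < k
  Card-positive {x = x} Px = injection⇒≤ (λ _ → x) (λ _ → Px) λ { zero zero _ → ≡.refl }

  -- if x ∈ Q were missing from P, adjoining it to an enumeration of P would inject Fin (suc k) into Q
  Card⇒⊇ : P Respects _≈_ → Decidable P → P ⊆ Q → Card P k → Card Q k → Q ⊆ P
  Card⇒⊇ {P = P} {Q = Q} {k = k} resp P? P⊆Q C D {x} Qx with P? x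
  ... | yes Px = Px
  ... | no ¬Px = ⊥-elim (ℕₚ.<-irrefl ≡.refl (injection⇒≤ e e∈Q e-injective D))
    where
    e : Fin (suc k) → Carrier
    e zero    = x
    e (suc i) = enum C i
    e∈Q : ∀ i → Q (e i)
    e∈Q zero    = Qx
    e∈Q (suc i) = P⊆Q (enum-∈ C i)
    e-injective : ∀ i j → e i ≈ e j → i ≡ j
    e-injective zero    zero    _  = ≡.refl
    e-injective zero    (suc j) eq = ⊥-elim (¬Px (resp (sym eq) (enum-∈ C j)))
    e-injective (suc i) zero    eq = ⊥-elim (¬Px (resp eq (enum-∈ C i)))
    e-injective (suc i) (suc j) eq = ≡.cong suc (enum-injective C i j eq)

  Card-× : ∀ {a b} (e : Fin a → Fin b → Carrier) → (∀ i j → P (e i j)) →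
           (∀ i j i′ j′ → e i j ≈ e i′ j′ → i ≡ i′ × j ≡ j′) →
           (∀ {x} → P x → ∃₂ λ i j → e i j ≈ x) → Card P (a * b)
  Card-× {a = a} {b = b} e e∈P e-injective e-surjective = record
    { enum            = uncurry e ∘ remQuot {a} b
    ; enum-∈          = λ z → uncurry e∈P (remQuot {a} b z)
    ; enum-injective  = λ z z′ eq → remQuot-injective z z′ (pair-injective _ _ eq)
    ; enum-surjective = λ Px → let i , j , eij≈x = e-surjective Px in
        combine i j , trans (reflexive (≡.cong (uncurry e) (Finₚ.remQuot-combine {a} i j))) eij≈x }
    where
    pair-injective : ∀ u v → uncurry e u ≈ uncurry e v → u ≡ v
    pair-injective (i , j) (i′ , j′) eq with e-injective i j i′ j′ eq
    ... | ≡.refl , ≡.refl = ≡.refl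
    remQuot-injective : ∀ z z′ → remQuot {a} b z ≡ remQuot b z′ → z ≡ z′
    remQuot-injective z z′ eq = begin
      z                                  ≡⟨ Finₚ.combine-remQuot {a} b z ⟨
      uncurry combine (remQuot {a} b z)  ≡⟨ ≡.cong (uncurry combine) eq ⟩
      uncurry combine (remQuot {a} b z′) ≡⟨ Finₚ.combine-remQuot {a} b z′ ⟩
      z′                                 ∎
      where open ≡.≡-Reasoning

  module Finite {n} (enum : Fin n → Carrier) (enum-injective : ∀ i j → enum i ≈ enum j → i ≡ j)
                (enum-surjective : ∀ x → ∃ λ i → enum i ≈ x) where

    _≟_ : ∀ x y → Dec (x ≈ y)
    x ≟ y with enum-surjective x | enum-surjective y
    ... | i , i≈x | j , j≈y with i Finₚ.≟ j
    ... | yes ≡.refl = yes (trans (sym i≈x) j≈y)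
    ... | no i≢j     = no λ x≈y → i≢j (enum-injective i j (trans i≈x (trans x≈y (sym j≈y))))

    ∃? : P Respects _≈_ → Decidable P → Dec (∃ P)
    ∃? resp P? with Finₚ.any? (P? ∘ enum)
    ... | yes (i , P[i]) = yes (enum i , P[i])
    ... | no ∄i          = no λ (x , Px) → let i , i≈x = enum-surjective x in ∄i (i , resp (sym i≈x) Px)

    Card-universal : (∀ x → P x) → Card P n
    Card-universal all = record
      { enum = enum ; enum-∈ = all ∘ enum ; enum-injective = enum-injective
      ; enum-surjective = λ {x} _ → enum-surjective x }

    Card-exists : P Respects _≈_ → Decidable P → ∃ (Card P)
    Card-exists {P = P} resp P? = length indices , record
      { enum            = enum ∘ lookup indices
      ; enum-∈          = λ i → proj₂ (∈-filter⁻ (P? ∘ enum) {xs = allFin n} (∈-lookup i))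
      ; enum-injective  = λ i j eq → lookup-injective unique i j (enum-injective _ _ eq)
      ; enum-surjective = surjective }
      where
      indices = filter (P? ∘ enum) (allFin n)
      unique : Unique indices
      unique = Uniqueₚ.filter⁺ (P? ∘ enum) (Uniqueₚ.allFin⁺ n)
      surjective : ∀ {x} → P x → ∃ λ i → enum (lookup indices i) ≈ x
      surjective {x} Px =
        let j , j≈x = enum-surjective x
            j∈ = ∈-filter⁺ (P? ∘ enum) (∈-allFin j) (resp (sym j≈x) Px)
        in Any.index j∈ , trans (reflexive (≡.cong enum (≡.sym (Anyₚ.lookup-index j∈)))) j≈x

module _ (G : AbelianGroup c₁ ℓ₁) (H : AbelianGroup c₂ ℓ₂) {φ} (hom : IsHom G H φ) where
  private
    module G = AbelianGroup G
    module CG = Counting G.setoid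
    module CH = Counting (AbelianGroup.setoid H)
  open AbelianGroup H
  open GroupMorphisms.IsGroupHomomorphism hom
  open Multiples G using () renaming (_⋆_ to _⋆ᴳ_)
  open Multiples H using (_⋆_)
  open import Algebra.Properties.Group G.group using (∙-cancelˡ)
  private module ≈ᴴ = Relation.Binary.Reasoning.Setoid setoid

  homo-⋆ : ∀ n x → φ (n ⋆ᴳ x) ≈ n ⋆ φ x
  homo-⋆ zero    x = ε-homo
  homo-⋆ (suc n) x = trans (homo x (n ⋆ᴳ x)) (∙-cong refl (homo-⋆ n x))

  Kernel : Pred G.Carrier ℓ₂
  Kernel x = φ x ≈ ε

  Image : Pred Carrier (c₁ ⊔ ℓ₂)
  Image y = ∃ λ x → φ x ≈ y

  -- translation by a chosen preimage of y maps the kernel bijectively onto the fibre over y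
  Card-preimage : {Q : Pred Carrier s} → Q Respects _≈_ → ∀ {k l} →
                  CH.Card (λ y → Q y × Image y) l → CG.Card Kernel k → CG.Card (Q ∘ φ) (l * k)
  Card-preimage {Q = Q} resp I K = CG.Card-× e e∈Q∘φ e-injective e-surjective
    where
    open CH using (enum; enum-∈; enum-injective; enum-surjective)
    σ : Fin _ → G.Carrier
    σ j = proj₁ (proj₂ (enum-∈ I j))
    e : Fin _ → Fin _ → G.Carrier
    e j i = σ j G.∙ CG.enum K i
    φ-e : ∀ j i → φ (e j i) ≈ enum I j
    φ-e j i = begin
      φ (σ j G.∙ CG.enum K i)   ≈⟨ homo (σ j) _ ⟩
      φ (σ j) ∙ φ (CG.enum K i) ≈⟨ ∙-cong (proj₂ (proj₂ (enum-∈ I j))) (CG.enum-∈ K i) ⟩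
      enum I j ∙ ε              ≈⟨ identityʳ _ ⟩
      enum I j                  ∎
      where open Relation.Binary.Reasoning.Setoid setoid
    e∈Q∘φ : ∀ j i → Q (φ (e j i))
    e∈Q∘φ j i = resp (sym (φ-e j i)) (proj₁ (enum-∈ I j))
    e-injective : ∀ j i j′ i′ → e j i G.≈ e j′ i′ → j ≡ j′ × i ≡ i′
    e-injective j i j′ i′ eq with enum-injective I j j′ (trans (sym (φ-e j i)) (trans (⟦⟧-cong eq) (φ-e j′ i′)))
    ... | ≡.refl = ≡.refl , CG.enum-injective K i i′ (∙-cancelˡ (σ j) _ _ eq)
    e-surjective : ∀ {x} → Q (φ x) → ∃₂ λ j i → e j i G.≈ x
    e-surjective {x} Qφx = j , i , (begin
      σ j G.∙ CG.enum K i          ≈⟨ G.∙-cong G.refl i≈t ⟩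
      σ j G.∙ (σ j G.⁻¹ G.∙ x)     ≈⟨ G.assoc _ _ _ ⟨
      (σ j G.∙ σ j G.⁻¹) G.∙ x     ≈⟨ G.∙-cong (G.inverseʳ (σ j)) G.refl ⟩
      G.ε G.∙ x                    ≈⟨ G.identityˡ x ⟩
      x                            ∎)
      where
      open Relation.Binary.Reasoning.Setoid G.setoid
      j = proj₁ (enum-surjective I (Qφx , x , refl))
      j≈φx : enum I j ≈ φ x
      j≈φx = proj₂ (enum-surjective I (Qφx , x , refl))
      σ⁻¹x∈kernel : Kernel (σ j G.⁻¹ G.∙ x)
      σ⁻¹x∈kernel = ≈ᴴ.begin
        φ (σ j G.⁻¹ G.∙ x)   ≈ᴴ.≈⟨ homo _ x ⟩
        φ (σ j G.⁻¹) ∙ φ x   ≈ᴴ.≈⟨ ∙-cong (⁻¹-homo (σ j)) refl ⟩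
        φ (σ j) ⁻¹ ∙ φ x     ≈ᴴ.≈⟨ ∙-cong (⁻¹-cong (trans (proj₂ (proj₂ (enum-∈ I j))) j≈φx)) refl ⟩
        φ x ⁻¹ ∙ φ x         ≈ᴴ.≈⟨ inverseˡ (φ x) ⟩
        ε                    ≈ᴴ.∎
      i = proj₁ (CG.enum-surjective K σ⁻¹x∈kernel)
      i≈t = proj₂ (CG.enum-surjective K σ⁻¹x∈kernel)

  Card-image : (∀ x y → φ x ≈ φ y → x G.≈ y) → {P : Pred G.Carrier s} → ∀ {k} →
               CG.Card P k → CH.Card (λ y → ∃ λ x → P x × φ x ≈ y) k
  Card-image φ-injective C = record
    { enum            = φ ∘ CG.enum C
    ; enum-∈          = λ i → CG.enum C i , CG.enum-∈ C i , refl
    ; enum-injective  = λ i j eq → CG.enum-injective C i j (φ-injective _ _ eq)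
    ; enum-surjective = λ (x , Px , φx≈y) → let i , i≈x = CG.enum-surjective C Px in
                          i , trans (⟦⟧-cong i≈x) φx≈y }

  order-homo : ∀ {p} → Prime p → IsPGroup G p →
    (∀ {x} → Kernel x → p ⋆ᴳ x G.≈ G.ε) → (∀ {x} → p ⋆ᴳ x G.≈ G.ε → Kernel x) →
    ∀ x → ¬ x G.≈ G.ε → ∀ m n → IsOrder G x m → IsOrder H (φ x) n → m ≡ p * n
  order-homo {p} p-prime p-group kernel⊆torsion torsion⊆kernel x x≉ε m n
             ord-x@(m>0 , m⋆x≈ε , m-minimal) (n>0 , n⋆φx≈ε , n-minimal) =
    ℕₚ.≤-antisym m≤p*n (≡.subst (p * n ≤_) p*m′≡m (ℕₚ.*-monoʳ-≤ p n≤m′))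
    where
    open Multiples G using (⋆-assoc; ⋆-congˡ)
    instance
      p≢0 : NonZero p
      p≢0 = prime⇒nonZero p-prime
    m≢1 : m ≢ 1
    m≢1 ≡.refl = x≉ε (G.trans (G.sym (G.identityʳ x)) m⋆x≈ε)
    m′ = m / p
    p*m′≡m : p * m′ ≡ m
    p*m′≡m = m*[n/m]≡n (let k , p^k⋆x≈ε = p-group x in
                        ∣prime^⇒∣ p-prime k (Multiples.IsOrder⇒∣ G ord-x p^k⋆x≈ε) m≢1)
    m′>0 : 0 < m′
    m′>0 = ℕₚ.*-cancelˡ-< p 0 m′ (≡.subst₂ _<_ (≡.sym (ℕₚ.*-zeroʳ p)) (≡.sym p*m′≡m) m>0)
    m′⋆x∈kernel : Kernel (m′ ⋆ᴳ x)
    m′⋆x∈kernel = torsion⊆kernel (G.trans (⋆-assoc p m′ x) (G.trans (⋆-congˡ x p*m′≡m) m⋆x≈ε))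
    n≤m′ : n ≤ m′
    n≤m′ = n-minimal m′ m′>0 (trans (sym (homo-⋆ m′ x)) m′⋆x∈kernel)
    m≤p*n : m ≤ p * n
    m≤p*n = m-minimal (p * n) (ℕ.>-nonZero⁻¹ (p * n) {{ℕₚ.m*n≢0 p n {{p≢0}} {{ℕ.>-nonZero n>0}}}})
      (G.trans (G.sym (⋆-assoc p n x)) (kernel⊆torsion (trans (homo-⋆ n x) n⋆φx≈ε)))

module PRank (G : AbelianGroup c ℓ) {p : ℕ} (p-prime : Prime p) where
  open AbelianGroup G
  open Multiples G
  open Congruence G p
  open Counting setoid using (Card; enum; enum-∈; enum-injective; enum-surjective; Card-×)
  open import Algebra.Properties.Group group using (∙-cancelˡ)
  open ∼-Reasoning

  private instance
    p≢0 : NonZero p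
    p≢0 = prime⇒nonZero p-prime

  PMultiple : Pred Carrier (c ⊔ ℓ)
  PMultiple y = ∃ λ z → p ⋆ z ≈ y

  Generates : ∀ k → (Fin k → Carrier) → Set (c ⊔ ℓ)
  Generates k xs = ∀ x → ∃ λ cs → x ∼ lincomb G k xs cs

  spans⇒generates : ∀ {k} (sp : SpansModP G p (λ _ → ⊤ {ℓ = s}) k) → Generates k (proj₁ sp)
  spans⇒generates (_ , _ , span) x = let cs , t , _ , x≈ = span x tt in cs , t , x≈

  generates⇒spans : ∀ {k xs} → Generates k xs → SpansModP G p (λ _ → ⊤ {ℓ = s}) k
  generates⇒spans {xs = xs} gen = xs , (λ _ → tt) , λ x _ → let cs , t , x≈ = gen x in cs , t , tt , x≈

  ⋆-invertible : ∀ {d} → ¬ p ∣ d → ∃ λ u → ∀ z → z ∼ u ⋆ d ⋆ z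
  ⋆-invertible {d} p∤d with coprime-Bézout (∤⇒coprime p-prime p∤d)
  ... | Bézout.+- x y 1+yp≡xd = x , λ z → ∼-sym (y ⋆ z , (begin-equality
    x ⋆ d ⋆ z        ≈⟨ ⋆-assoc x d z ⟩
    (x * d) ⋆ z      ≈⟨ ⋆-congˡ z 1+yp≡xd ⟨
    z ∙ (y * p) ⋆ z  ≈⟨ ∙-cong refl (⋆-congˡ z (ℕₚ.*-comm y p)) ⟩
    z ∙ (p * y) ⋆ z  ≈⟨ ∙-cong refl (⋆-assoc p y z) ⟨
    z ∙ p ⋆ y ⋆ z    ∎))
  ... | Bézout.-+ x y 1+xd≡yp = pred p * x , λ z → begin
    z                     ∼⟨ ∙∼ε⇒∼pred-⋆ (z∙x⋆d⋆z∼ε z) ⟩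
    pred p ⋆ x ⋆ d ⋆ z    ≈⟨ ⋆-assoc (pred p) x _ ⟩
    (pred p * x) ⋆ d ⋆ z  ∎
    where
    z∙x⋆d⋆z∼ε : ∀ z → z ∙ x ⋆ d ⋆ z ∼ ε
    z∙x⋆d⋆z∼ε z = begin
      z ∙ x ⋆ d ⋆ z    ≈⟨ ∙-cong refl (⋆-assoc x d z) ⟩
      (1 + x * d) ⋆ z  ≈⟨ ⋆-congˡ z 1+xd≡yp ⟩
      (y * p) ⋆ z      ≈⟨ ⋆-congˡ z (ℕₚ.*-comm y p) ⟩
      (p * y) ⋆ z      ≈⟨ ⋆-assoc p y z ⟨
      p ⋆ y ⋆ z        ∼⟨ p⋆x∼ε (y ⋆ z) ⟩
      ε                ∎

  generates-punchOut : ∀ {k xs} → Generates (suc k) xs → (d : Fin (suc k) → ℕ) →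
                       lincomb G (suc k) xs d ∼ ε → ∀ j → ¬ p ∣ d j → Generates k (xs ∘ punchIn j)
  generates-punchOut {k} {xs} gen d relation j p∤dj x =
    let cs , x∼ = gen x in (λ i → cs j * w i + cs (punchIn j i)) , (begin
      x                                                       ∼⟨ x∼ ⟩
      lincomb G (suc k) xs cs                                 ≈⟨ lincomb-punchIn k xs cs j ⟩
      cs j ⋆ xs j ∙ lincomb G k ys (cs ∘ punchIn j)            ∼⟨ ∼-∙-cong (∼-⋆-cong (cs j) xs[j]∼) (∼-reflexive refl) ⟩
      cs j ⋆ lincomb G k ys w ∙ lincomb G k ys (cs ∘ punchIn j) ≈⟨ ∙-cong (⋆-lincomb (cs j) k ys w) refl ⟩
      lincomb G k ys (λ i → cs j * w i) ∙ lincomb G k ys (cs ∘ punchIn j)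
                                                              ≈⟨ lincomb-+ k ys _ _ ⟨
      lincomb G k ys (λ i → cs j * w i + cs (punchIn j i))     ∎)
    where
    ys = xs ∘ punchIn j
    u = proj₁ (⋆-invertible p∤dj)
    w : Fin k → ℕ
    w i = u * pred p * d (punchIn j i)
    xs[j]∼ : xs j ∼ lincomb G k ys w
    xs[j]∼ = begin
      xs j                                          ∼⟨ proj₂ (⋆-invertible p∤dj) (xs j) ⟩
      u ⋆ d j ⋆ xs j                                ∼⟨ ∼-⋆-cong u (∙∼ε⇒∼pred-⋆ (begin
        d j ⋆ xs j ∙ lincomb G k ys (d ∘ punchIn j) ≈⟨ lincomb-punchIn k xs d j ⟨
        lincomb G (suc k) xs d                      ∼⟨ relation ⟩
        ε                                           ∎)) ⟩
      u ⋆ pred p ⋆ lincomb G k ys (d ∘ punchIn j)   ≈⟨ ⋆-assoc u (pred p) _ ⟩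
      (u * pred p) ⋆ lincomb G k ys (d ∘ punchIn j) ≈⟨ ⋆-lincomb (u * pred p) k ys _ ⟩
      lincomb G k ys w                              ∎

  -- a i ≢ b i would give a relation with a coefficient prime to p, so a shorter family would generate
  minimal⇒independent : ∀ {r xs} → Generates r xs →
    (∀ k → SpansModP G p (λ _ → ⊤ {ℓ = s}) k → r ≤ k) →
    (a b : Fin r → Fin p) → lincomb G r xs (toℕ ∘ a) ∼ lincomb G r xs (toℕ ∘ b) → ∀ i → a i ≡ b i
  minimal⇒independent {s = s} {suc r} {xs} gen minimal a b La∼Lb i with a i Finₚ.≟ b i
  ... | yes ai≡bi = ai≡bi
  ... | no  ai≢bi = ⊥-elim (ℕₚ.<-irrefl ≡.refl
          (minimal r (generates⇒spans {s = s} (generates-punchOut {xs = xs} gen d relation i p∤d[i]))))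
    where
    L : (Fin (suc r) → ℕ) → Carrier
    L = lincomb G (suc r) xs
    d : Fin (suc r) → ℕ
    d l = toℕ (a l) + pred p * toℕ (b l)
    p∤d[i] : ¬ p ∣ d i
    p∤d[i] = distinct⇒∤ (Finₚ.toℕ<n (a i)) (Finₚ.toℕ<n (b i)) (ai≢bi ∘ Finₚ.toℕ-injective)
    relation : L d ∼ ε
    relation = begin
      L d                                        ≈⟨ lincomb-+ (suc r) xs (toℕ ∘ a) (λ l → pred p * toℕ (b l)) ⟩
      L (toℕ ∘ a) ∙ L (λ l → pred p * toℕ (b l)) ≈⟨ ∙-cong refl (⋆-lincomb (pred p) (suc r) xs (toℕ ∘ b)) ⟨
      L (toℕ ∘ a) ∙ pred p ⋆ L (toℕ ∘ b)         ∼⟨ ∼-∙-cong La∼Lb (∼-reflexive refl) ⟩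
      L (toℕ ∘ b) ∙ pred p ⋆ L (toℕ ∘ b)         ≈⟨ ⋆-congˡ _ (ℕₚ.suc-pred p) ⟩
      p ⋆ L (toℕ ∘ b)                            ∼⟨ p⋆x∼ε _ ⟩
      ε                                          ∎

  ⋆∼%-⋆ : ∀ n x → n ⋆ x ∼ (n % p) ⋆ x
  ⋆∼%-⋆ n x = (n / p) ⋆ x , (begin-equality
    n ⋆ x                            ≈⟨ ⋆-congˡ x (m≡m%n+[m/n]*n n p) ⟩
    (n % p + n / p * p) ⋆ x          ≈⟨ ⋆-homo-+ (n % p) _ x ⟩
    (n % p) ⋆ x ∙ (n / p * p) ⋆ x    ≈⟨ ∙-cong refl (⋆-congˡ x (ℕₚ.*-comm (n / p) p)) ⟩
    (n % p) ⋆ x ∙ (p * (n / p)) ⋆ x  ≈⟨ ∙-cong refl (⋆-assoc p (n / p) x) ⟨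
    (n % p) ⋆ x ∙ p ⋆ (n / p) ⋆ x    ∎)

  Card-rank : ∀ {r t} → HasPRank G p (λ _ → ⊤ {ℓ = s}) r → Card PMultiple t →
              Card (λ _ → ⊤ {ℓ = s}) (p ^ r * t)
  Card-rank {s = s} {r} ((xs , _ , span) , minimal) M = Card-× e (λ _ _ → tt) e-injective e-surjective
    where
    gen : Generates r xs
    gen = spans⇒generates {s = s} (xs , (λ _ → tt) , span)
    L : (Fin r → Fin p) → Carrier
    L a = lincomb G r xs (toℕ ∘ a)
    e : Fin (p ^ r) → Fin _ → Carrier
    e a j = L (finToFun a) ∙ enum M j
    e∼L : ∀ a j → e a j ∼ L (finToFun a)
    e∼L a j = let z , p⋆z≈ = enum-∈ M j in z , ∙-cong refl (sym p⋆z≈)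
    e-injective : ∀ a j a′ j′ → e a j ≈ e a′ j′ → a ≡ a′ × j ≡ j′
    e-injective a j a′ j′ eq with finToFun-injective {r} {p}
      (minimal⇒independent {s = s} gen minimal (finToFun a) (finToFun a′)
        (∼-trans (∼-sym (e∼L a j)) (∼-trans (∼-reflexive eq) (e∼L a′ j′))))
    ... | ≡.refl = ≡.refl , enum-injective M j j′ (∙-cancelˡ _ _ _ eq)
    e-surjective : ∀ {x} → ⊤ {ℓ = s} → ∃₂ λ a j → e a j ≈ x
    e-surjective {x} _ = funToFin cs′ , j , (begin-equality
      L (finToFun (funToFin cs′)) ∙ enum M j  ≈⟨ ∙-cong (lincomb-cong r xs (≡.cong toℕ ∘ Finₚ.finToFun-funToFin cs′))
                                                         j≈ ⟩
      L cs′ ∙ p ⋆ u                           ≈⟨ x≈ ⟨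
      x                                       ∎)
      where
      cs = proj₁ (gen x)
      cs′ : Fin r → Fin p
      cs′ i = fromℕ< (m%n<n (cs i) p)
      x∼ : x ∼ L cs′
      x∼ = ∼-trans (proj₂ (gen x)) (lincomb-∼ r xs cs (toℕ ∘ cs′) λ i →
             ∼-trans (⋆∼%-⋆ (cs i) (xs i))
                     (∼-reflexive (⋆-congˡ (xs i) (≡.sym (Finₚ.toℕ-fromℕ< (m%n<n (cs i) p))))))
      u = proj₁ x∼
      x≈ = proj₂ x∼
      j = proj₁ (enum-surjective M (u , refl))
      j≈ = proj₂ (enum-surjective M (u , refl))

module FiniteRank (G : AbelianGroup c ℓ) {p : ℕ} (p-prime : Prime p) {n} (finite : HasCard G n) where
  open AbelianGroup G public
  open Multiples G
  open PRank G p-prime using (Card-rank)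
  open PRank G p-prime public using (PMultiple)
  open Counting setoid public
  open Finite (proj₁ finite) (proj₁ (proj₂ finite)) (proj₂ (proj₂ finite)) public

  Torsion : Pred Carrier ℓ
  Torsion x = p ⋆ x ≈ ε

  PMultiple-resp : PMultiple Respects _≈_
  PMultiple-resp y≈y′ (z , p⋆z≈y) = z , trans p⋆z≈y y≈y′

  PMultiple? : Decidable PMultiple
  PMultiple? y = ∃? (λ z≈z′ p⋆z≈y → trans (⋆-congʳ p (sym z≈z′)) p⋆z≈y) (λ z → (p ⋆ z) ≟ y)

  |pG| : ℕ
  |pG| = proj₁ (Card-exists PMultiple-resp PMultiple?)

  Card-pG : Card PMultiple |pG|
  Card-pG = proj₂ (Card-exists PMultiple-resp PMultiple?)

  |pG|≢0 : NonZero |pG|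
  |pG|≢0 = ℕ.>-nonZero (Card-positive (ε , ⋆-ε p) Card-pG)

  card≡p^rank*|pG| : ∀ {r} → HasPRank G p (λ _ → ⊤ {ℓ = s}) r → n ≡ p ^ r * |pG|
  card≡p^rank*|pG| {s = s} rank =
    Card-unique (Card-universal {P = λ _ → ⊤ {ℓ = s}} (λ _ → tt)) (Card-rank rank Card-pG)

  Card-torsion : ∀ {r} → HasPRank G p (λ _ → ⊤ {ℓ = s}) r → Card Torsion (p ^ r)
  Card-torsion {s = s} {r} rank = ≡.subst (Card Torsion) k≡p^r K
    where
    torsion = Card-exists (λ x≈y p⋆x≈ε → trans (⋆-congʳ p (sym x≈y)) p⋆x≈ε) (λ x → (p ⋆ x) ≟ ε)
    k = proj₁ torsion
    K = proj₂ torsion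
    n≡|pG|*k : n ≡ |pG| * k
    n≡|pG|*k = Card-unique (Card-universal {P = λ _ → ⊤ {ℓ = s}} (λ _ → tt))
      (Card-preimage G G (⋆-isHom p) {Q = λ _ → ⊤ {ℓ = s}} (λ _ _ → tt)
                     (Card-resp (λ m → tt , m) proj₂ Card-pG) K)
    k≡p^r : k ≡ p ^ r
    k≡p^r = ℕₚ.*-cancelˡ-≡ k (p ^ r) |pG| {{|pG|≢0}}
      (≡.trans (≡.sym n≡|pG|*k) (≡.trans (card≡p^rank*|pG| rank) (ℕₚ.*-comm (p ^ r) |pG|)))

module NormAndInclusion
  {a ℓa b ℓb} {p : ℕ} (p-prime : Prime p) (A : AbelianGroup a ℓa) (B : AbelianGroup b ℓb)
  {nA nB : ℕ} (finite-A : HasCard A nA) (finite-B : HasCard B nB)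
  {N ι} (N-hom : IsHom B A N) (ι-hom : IsHom A B ι)
  (N-surjective : ∀ x → ∃ λ y → AbelianGroup._≈_ A (N y) x)
  (ι-injective : ∀ x y → AbelianGroup._≈_ B (ι x) (ι y) → AbelianGroup._≈_ A x y)
  {r : ℕ} (rank-A : HasPRank A p (λ _ → ⊤ {ℓ = a}) r) (rank-B : HasPRank B p (λ _ → ⊤ {ℓ = b}) r)
  (nB≡p^r*nA : nB ≡ p ^ r * nA)
  (N∘ι : ∀ x → AbelianGroup._≈_ A (N (ι x)) (_·_ A p x)) where

  private
    module A = FiniteRank A p-prime finite-A
    module B = FiniteRank B p-prime finite-B
    module N = GroupMorphisms.IsGroupHomomorphism N-hom
    module ι = GroupMorphisms.IsGroupHomomorphism ι-hom
  open Multiples A using () renaming (_⋆_ to _⋆ᴬ_)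
  open Multiples B using () renaming (_⋆_ to _⋆ᴮ_)
  open A using () renaming (_≈_ to _≈ᴬ_; ε to εᴬ)
  open B using () renaming (_≈_ to _≈ᴮ_; ε to εᴮ)

  Card-kernel : B.Card (Kernel B A N-hom) (p ^ r)
  Card-kernel = ≡.subst (B.Card (Kernel B A N-hom)) k≡p^r K
    where
    kernel = B.Card-exists (λ y≈y′ Ny≈ε → A.trans (N.⟦⟧-cong (B.sym y≈y′)) Ny≈ε) (λ y → N y A.≟ εᴬ)
    k = proj₁ kernel
    K = proj₂ kernel
    Card-A : A.Card (λ _ → ⊤ {ℓ = a}) nA
    Card-A = A.Card-universal (λ _ → tt)
    nA≢0 : NonZero nA
    nA≢0 = ℕ.>-nonZero (A.Card-positive {x = εᴬ} tt Card-A)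
    nB≡nA*k : nB ≡ nA * k
    nB≡nA*k = B.Card-unique (B.Card-universal {P = λ _ → ⊤ {ℓ = b}} _)
      (Card-preimage B A N-hom {Q = λ _ → ⊤ {ℓ = b}} (λ _ _ → tt)
        (A.Card-resp (λ {x} _ → tt , N-surjective x) (λ _ → tt) Card-A) K)
    k≡p^r : k ≡ p ^ r
    k≡p^r = ℕₚ.*-cancelˡ-≡ k (p ^ r) nA {{nA≢0}}
      (≡.trans (≡.sym nB≡nA*k) (≡.trans nB≡p^r*nA (ℕₚ.*-comm (p ^ r) nA)))

  ιTorsion : Pred B.Carrier (a ⊔ ℓa ⊔ ℓb)
  ιTorsion y = ∃ λ x → A.Torsion x × ι x ≈ᴮ y

  ιTorsion-resp : ιTorsion Respects _≈ᴮ_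
  ιTorsion-resp y≈y′ (x , x∈A[p] , ιx≈y) = x , x∈A[p] , B.trans ιx≈y y≈y′

  ιTorsion? : Decidable ιTorsion
  ιTorsion? y = A.∃? resp (λ x → ((p ⋆ᴬ x) A.≟ εᴬ) ×-dec (ι x B.≟ y))
    where
    resp : (λ x → A.Torsion x × ι x ≈ᴮ y) Respects _≈ᴬ_
    resp x≈x′ (p⋆x≈ε , ιx≈y) =
      A.trans (Multiples.⋆-congʳ A p (A.sym x≈x′)) p⋆x≈ε , B.trans (ι.⟦⟧-cong (A.sym x≈x′)) ιx≈y

  Card-ιTorsion : B.Card ιTorsion (p ^ r)
  Card-ιTorsion = Card-image A B ι-hom ι-injective (A.Card-torsion rank-A)

  ιTorsion⊆kernel : ιTorsion ⊆ Kernel B A N-hom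
  ιTorsion⊆kernel {y} (x , p⋆x≈ε , ιx≈y) = begin
    N y      ≈⟨ N.⟦⟧-cong ιx≈y ⟨
    N (ι x)  ≈⟨ N∘ι x ⟩
    p ⋆ᴬ x   ≈⟨ p⋆x≈ε ⟩
    εᴬ       ∎
    where open Relation.Binary.Reasoning.Setoid A.setoid

  ιTorsion⊆torsion : ιTorsion ⊆ B.Torsion
  ιTorsion⊆torsion {y} (x , p⋆x≈ε , ιx≈y) = begin
    p ⋆ᴮ y      ≈⟨ Multiples.⋆-congʳ B p ιx≈y ⟨
    p ⋆ᴮ ι x    ≈⟨ homo-⋆ A B ι-hom p x ⟨
    ι (p ⋆ᴬ x)  ≈⟨ ι.⟦⟧-cong p⋆x≈ε ⟩
    ι εᴬ        ≈⟨ ι.ε-homo ⟩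
    εᴮ          ∎
    where open Relation.Binary.Reasoning.Setoid B.setoid

  kernel⊆torsion : Kernel B A N-hom ⊆ B.Torsion
  kernel⊆torsion = ιTorsion⊆torsion ∘
    B.Card⇒⊇ ιTorsion-resp ιTorsion? ιTorsion⊆kernel Card-ιTorsion Card-kernel

  torsion⊆kernel : B.Torsion ⊆ Kernel B A N-hom
  torsion⊆kernel = ιTorsion⊆kernel ∘
    B.Card⇒⊇ ιTorsion-resp ιTorsion? ιTorsion⊆torsion Card-ιTorsion (B.Card-torsion rank-B)

  ιImage : Pred B.Carrier (a ⊔ ℓb)
  ιImage = Image A B ι-hom

  ιImage-resp : ιImage Respects _≈ᴮ_
  ιImage-resp y≈y′ (x , ιx≈y) = x , B.trans ιx≈y y≈y′

  ιImage? : Decidable ιImage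
  ιImage? y = A.∃? (λ x≈x′ ιx≈y → B.trans (ι.⟦⟧-cong (A.sym x≈x′)) ιx≈y) (λ x → ι x B.≟ y)

  Card-ιImage : B.Card ιImage nA
  Card-ιImage = B.Card-resp (λ (x , _ , ιx≈y) → x , ιx≈y) (λ (x , ιx≈y) → x , tt , ιx≈y)
    (Card-image A B ι-hom ι-injective (A.Card-universal {P = λ _ → ⊤ {ℓ = a}} _))

  ιImage⊆N⁻¹[pA] : ιImage ⊆ A.PMultiple ∘ N
  ιImage⊆N⁻¹[pA] (x , ιx≈y) = x , A.trans (A.sym (N∘ι x)) (N.⟦⟧-cong ιx≈y)

  Card-N⁻¹[pA] : B.Card (A.PMultiple ∘ N) nA
  Card-N⁻¹[pA] = ≡.subst (B.Card (A.PMultiple ∘ N))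
    (≡.trans (ℕₚ.*-comm A.|pG| (p ^ r)) (≡.sym (A.card≡p^rank*|pG| rank-A)))
    (Card-preimage B A N-hom A.PMultiple-resp
      (A.Card-resp (λ {x} x∈pA → x∈pA , N-surjective x) proj₁ A.Card-pG) Card-kernel)

  pB⊆ιImage : B.PMultiple ⊆ ιImage
  pB⊆ιImage (z , p⋆z≈y) =
    B.Card⇒⊇ ιImage-resp ιImage? ιImage⊆N⁻¹[pA] Card-ιImage Card-N⁻¹[pA]
      (N z , A.trans (A.sym (homo-⋆ B A N-hom p z)) (N.⟦⟧-cong p⋆z≈y))

  ιImage⊆pB : ιImage ⊆ B.PMultiple
  ιImage⊆pB = B.Card⇒⊇ B.PMultiple-resp B.PMultiple? pB⊆ιImage
    (≡.subst (B.Card B.PMultiple) |pB|≡nA B.Card-pG) Card-ιImage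
    where
    |pB|≡nA : B.|pG| ≡ nA
    |pB|≡nA = ℕₚ.*-cancelˡ-≡ B.|pG| nA (p ^ r) {{ℕₚ.m^n≢0 p r {{prime⇒nonZero p-prime}}}}
      (≡.trans (≡.sym (B.card≡p^rank*|pG| rank-B)) nB≡p^r*nA)

lemma5 : ∀ {a ℓa b ℓb : Level} (p : ℕ) → Prime p →
    (A : AbelianGroup a ℓa) (B : AbelianGroup b ℓb) →
    (nA nB : ℕ) → HasCard A nA → HasCard B nB →
    IsPGroup A p → IsPGroup B p →
    (N : AbelianGroup.Carrier B → AbelianGroup.Carrier A) →
    (ι : AbelianGroup.Carrier A → AbelianGroup.Carrier B) →
    IsHom B A N → IsHom A B ι →
    (∀ x → ∃ λ y → AbelianGroup._≈_ A (N y) x) →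
    (∀ x y → AbelianGroup._≈_ B (ι x) (ι y) → AbelianGroup._≈_ A x y) →
    (r : ℕ) → HasPRank A p (λ _ → ⊤ {ℓ = a}) r → HasPRank B p (λ _ → ⊤ {ℓ = b}) r →
    nB ≡ p ^ r * nA →
    (∀ x → AbelianGroup._≈_ A (N (ι x)) (_·_ A p x)) →
    HasPRank B p (λ y → ∃ λ x → AbelianGroup._≈_ B (ι x) y) r →
    ((∀ y → (∃ λ x → AbelianGroup._≈_ B (ι x) y) → (∃ λ z → AbelianGroup._≈_ B (_·_ B p z) y))
     × (∀ y → (∃ λ z → AbelianGroup._≈_ B (_·_ B p z) y) → (∃ λ x → AbelianGroup._≈_ B (ι x) y)))
    × (∀ x → ¬ AbelianGroup._≈_ B x (AbelianGroup.ε B) →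
         ∀ m n → IsOrder B x m → IsOrder A (N x) n → m ≡ p * n)
lemma5 p p-prime A B nA nB finite-A finite-B _ p-group-B N ι N-hom ι-hom N-surjective ι-injective
       r rank-A rank-B nB≡p^r*nA N∘ι _ =
  ((λ _ → ιImage⊆pB) , (λ _ → pB⊆ιImage)) ,
  order-homo B A N-hom p-prime p-group-B kernel⊆torsion torsion⊆kernel
  where
  open NormAndInclusion p-prime A B finite-A finite-B N-hom ι-hom N-surjective ι-injective
                        rank-A rank-B nB≡p^r*nA N∘ι
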